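{- Let $\mathcal B$ be a branch in an $\mathsf{OTAB}$ tableau. (1) Let $A(\mathcal B)$ be the set of formulas $\psi$ such that $T\psi$ is an unmarked node on $\mathcal B$. If $T\phi$ appears on $\mathcal B$, then $A(\mathcal B)\vdash\phi$ has an $\mathsf{LK}$-proof of size polynomial in the size of the tableau. (2) Let $B(\mathcal B)$ be the set of formulas $\psi$ such that $F\psi$ is an unmarked node on $\mathcal B$. If $F\phi$ appears on $\mathcal B$, then $\phi\vdash B(\mathcal B)$ has an $\mathsf{LK}$-proof of size polynomial in the size of the tableau.
   Context: $\mathsf{LK}$ is Gentzen's propositional sequent calculus (sequents $\Gamma\vdash\Delta$ of finite sets of formulas; axioms $A\vdash A$, $\bot\vdash$, $\vdash\top$; weakening; standard left/right rules for $\neg,\wedge,\vee,\rightarrow$; cut). $\mathsf{OTAB}$ (Olivetti's tableau for minimal entailment): nodes carry signed formulas $T\phi$/$F\phi$, marked or unmarked. $\alpha$-type signed formulas (components $\alpha_1,\alpha_2$): $T(A\wedge B)$: $TA,TB$; $F\neg(A\wedge B)$: $F\neg A,F\neg B$; $T\neg(A\vee B)$: $T\neg A,T\neg B$; $F(A\vee B)$: $FA,FB$; $T\neg(A\rightarrow B)$: $TA,T\neg B$; $F(A\rightarrow B)$: $F\neg A,FB$; $T\neg\neg A$: $TA,TA$; $F\neg\neg A$: $FA,FA$. $\beta$-type (components $\beta_1,\beta_2$): $T(A\vee B)$: $TA,TB$; $F\neg(A\vee B)$: $F\neg A,F\neg B$; $T\neg(A\wedge B)$: $T\neg A,T\neg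 B$; $F(A\wedge B)$: $FA,FB$; $T(A\rightarrow B)$: $T\neg A,TB$; $F\neg(A\rightarrow B)$: $FA,F\neg B$. A tableau for $\Gamma\vdash_M\Delta$ starts with one branch of unmarked $T\gamma$ ($\gamma\in\Gamma$), $F\delta$ ($\delta\in\Delta$) and is extended by: (A) mark an unmarked $\alpha$-type node of branch $\mathcal B$ and append unmarked $\alpha_1,\alpha_2$ to $\mathcal B$; (B) mark an unmarked $\beta$-type node of $\mathcal B$ and split $\mathcal B$ into a branch extended by unmarked $\beta_1$ and one extended by unmarked $\beta_2$. -}

module Defs where

open import Data.Nat using (ℕ; zero; suc; _+_; _*_; _^_; _≤_)
open import Data.Bool using (Bool; true; false)
open import Data.List using (List; []; _∷_; _++_; length; [_]; map)
open import Data.List.Membership.Propositional using (_∈_)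
open import Data.List.Relation.Binary.Subset.Propositional using (_⊆_)
open import Data.Product using (_×_; _,_; Σ; ∃)
open import Data.Fin using (Fin)
open import Data.List.Base using (lookup; updateAt)
open import Relation.Binary.PropositionalEquality using (_≡_)

data Formula : Set where
  atom : ℕ → Formula
  ⊥'   : Formula
  ⊤'   : Formula
  ¬'_  : Formula → Formula
  _∧'_ : Formula → Formula → Formula
  _∨'_ : Formula → Formula → Formula
  _⇒'_ : Formula → Formula → Formula

infix  30 ¬'_
infixr 20 _∧'_
infixr 19 _∨'_
infixr 18 _⇒'_

fsize : Formula → ℕ
fsize (atom _) = 1
fsize ⊥' = 1
fsize ⊤' = 1
fsize (¬' A) = suc (fsize A)
fsize (A ∧' B) = suc (fsize A + fsize B)
fsize (A ∨' B) = suc (fsize A + fsize B)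
fsize (A ⇒' B) = suc (fsize A + fsize B)

lsize : List Formula → ℕ
lsize [] = 0
lsize (A ∷ Γ) = fsize A + lsize Γ

-- LK.  Sequents Γ ⊢ Δ are finite sets, represented by lists; the
-- weakening rule is taken modulo set inclusion (so exchange and
-- contraction, which are invisible for sets, are absorbed by it).

data LK : List Formula → List Formula → Set where
  ax   : ∀ A → LK [ A ] [ A ]
  ⊥L   : LK [ ⊥' ] []
  ⊤R   : LK [] [ ⊤' ]
  wk   : ∀ {Γ Δ Γ' Δ'} → Γ ⊆ Γ' → Δ ⊆ Δ' → LK Γ Δ → LK Γ' Δ'
  ¬L   : ∀ {Γ Δ A} → LK Γ (A ∷ Δ) → LK (¬' A ∷ Γ) Δ
  ¬R   : ∀ {Γ Δ A} → LK (A ∷ Γ) Δ → LK Γ (¬' A ∷ Δ)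
  ∧L₁  : ∀ {Γ Δ A B} → LK (A ∷ Γ) Δ → LK (A ∧' B ∷ Γ) Δ
  ∧L₂  : ∀ {Γ Δ A B} → LK (B ∷ Γ) Δ → LK (A ∧' B ∷ Γ) Δ
  ∧R   : ∀ {Γ Δ A B} → LK Γ (A ∷ Δ) → LK Γ (B ∷ Δ) → LK Γ (A ∧' B ∷ Δ)
  ∨L   : ∀ {Γ Δ A B} → LK (A ∷ Γ) Δ → LK (B ∷ Γ) Δ → LK (A ∨' B ∷ Γ) Δ
  ∨R₁  : ∀ {Γ Δ A B} → LK Γ (A ∷ Δ) → LK Γ (A ∨' B ∷ Δ)
  ∨R₂  : ∀ {Γ Δ A B} → LK Γ (B ∷ Δ) → LK Γ (A ∨' B ∷ Δ)
  ⇒L   : ∀ {Γ Δ A B} → LK Γ (A ∷ Δ) → LK (B ∷ Γ) Δ → LK (A ⇒' B ∷ Γ) Δ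
  ⇒R   : ∀ {Γ Δ A B} → LK (A ∷ Γ) (B ∷ Δ) → LK Γ (A ⇒' B ∷ Δ)
  cut  : ∀ {Γ Δ} A → LK Γ (A ∷ Δ) → LK (A ∷ Γ) Δ → LK Γ Δ

lkSize : ∀ {Γ Δ} → LK Γ Δ → ℕ
lkSize {Γ} {Δ} p = suc (lsize Γ + lsize Δ) + sub p
  where
  sub : ∀ {Γ Δ} → LK Γ Δ → ℕ
  sub (ax _) = 0
  sub ⊥L = 0
  sub ⊤R = 0
  sub (wk _ _ q) = lkSize q
  sub (¬L q) = lkSize q
  sub (¬R q) = lkSize q
  sub (∧L₁ q) = lkSize q
  sub (∧L₂ q) = lkSize q
  sub (∧R q r) = lkSize q + lkSize r
  sub (∨L q r) = lkSize q + lkSize r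
  sub (∨R₁ q) = lkSize q
  sub (∨R₂ q) = lkSize q
  sub (⇒L q r) = lkSize q + lkSize r
  sub (⇒R q) = lkSize q
  sub (cut _ q r) = lkSize q + lkSize r

data Sign : Set where
  T F : Sign

Signed : Set
Signed = Sign × Formula

ssize : Signed → ℕ
ssize (_ , A) = fsize A

data IsAlpha : Signed → Signed → Signed → Set where
  α-T∧   : ∀ A B → IsAlpha (T , A ∧' B) (T , A) (T , B)
  α-F¬∧  : ∀ A B → IsAlpha (F , ¬' (A ∧' B)) (F , ¬' A) (F , ¬' B)
  α-T¬∨  : ∀ A B → IsAlpha (T , ¬' (A ∨' B)) (T , ¬' A) (T , ¬' B)
  α-F∨   : ∀ A B → IsAlpha (F , A ∨' B) (F , A) (F , B)
  α-T¬⇒  : ∀ A B → IsAlpha (T , ¬' (A ⇒' B)) (T , A) (T , ¬' B)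
  α-F⇒   : ∀ A B → IsAlpha (F , A ⇒' B) (F , ¬' A) (F , B)
  α-T¬¬  : ∀ A → IsAlpha (T , ¬' ¬' A) (T , A) (T , A)
  α-F¬¬  : ∀ A → IsAlpha (F , ¬' ¬' A) (F , A) (F , A)

data IsBeta : Signed → Signed → Signed → Set where
  β-T∨   : ∀ A B → IsBeta (T , A ∨' B) (T , A) (T , B)
  β-F¬∨  : ∀ A B → IsBeta (F , ¬' (A ∨' B)) (F , ¬' A) (F , ¬' B)
  β-T¬∧  : ∀ A B → IsBeta (T , ¬' (A ∧' B)) (T , ¬' A) (T , ¬' B)
  β-F∧   : ∀ A B → IsBeta (F , A ∧' B) (F , A) (F , B)
  β-T⇒   : ∀ A B → IsBeta (T , A ⇒' B) (T , ¬' A) (T , B)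
  β-F¬⇒  : ∀ A B → IsBeta (F , ¬' (A ⇒' B)) (F , A) (F , ¬' B)

-- A node on a branch: a signed formula together with its mark
-- (true = marked).  A branch lists its nodes from the root down.
Node : Set
Node = Signed × Bool

Branch : Set
Branch = List Node

unmarked : Signed → Node
unmarked s = (s , false)

mark : Node → Node
mark (s , _) = (s , true)

initBranch : List Formula → List Formula → Branch
initBranch Γ Δ = map (λ γ → unmarked (T , γ)) Γ
              ++ map (λ δ → unmarked (F , δ)) Δ

initSize : List Formula → List Formula → ℕ
initSize Γ Δ = lsize Γ + lsize Δ

-- OTAB-Tableau Γ Δ bs n : there is an OTAB tableau for Γ ⊢_M Δ whose
-- branches (root-to-leaf paths) are exactly the list bs and whose size
-- (total number of symbols of the formulas at its nodes, every tree node
-- counted once) is n.  Marks are recorded per branch.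
data OTAB (Γ Δ : List Formula) : List Branch → ℕ → Set where
  init  : OTAB Γ Δ [ initBranch Γ Δ ] (initSize Γ Δ)
  ruleA : ∀ {bs₁ bs₂ n} (b : Branch) (i : Fin (length b)) {s a₁ a₂} →
          OTAB Γ Δ (bs₁ ++ b ∷ bs₂) n →
          lookup b i ≡ unmarked s →
          IsAlpha s a₁ a₂ →
          OTAB Γ Δ (bs₁ ++ (updateAt b i mark ++ unmarked a₁ ∷ unmarked a₂ ∷ []) ∷ bs₂)
                   (n + ssize a₁ + ssize a₂)
  ruleB : ∀ {bs₁ bs₂ n} (b : Branch) (i : Fin (length b)) {s b₁ b₂} →
          OTAB Γ Δ (bs₁ ++ b ∷ bs₂) n →
          lookup b i ≡ unmarked s →
          IsBeta s b₁ b₂ →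
          OTAB Γ Δ (bs₁ ++ (updateAt b i mark ++ [ unmarked b₁ ])
                        ∷ (updateAt b i mark ++ [ unmarked b₂ ]) ∷ bs₂)
                   (n + ssize b₁ + ssize b₂)

unmarkedWith : Sign → Branch → List Formula
unmarkedWith σ [] = []
unmarkedWith T (((T , ψ) , false) ∷ b) = ψ ∷ unmarkedWith T b
unmarkedWith F (((F , ψ) , false) ∷ b) = ψ ∷ unmarkedWith F b
unmarkedWith σ (_ ∷ b) = unmarkedWith σ b

A[_] : Branch → List Formula
A[ b ] = unmarkedWith T b

B[_] : Branch → List Formula
B[ b ] = unmarkedWith F b

OnBranch : Signed → Branch → Set
OnBranch s b = ∃ λ m → (s , m) ∈ b

-- By induction on the tableau: on every branch b of a tableau of size n, each
-- signed formula Tφ (resp. Fφ) has an LK-proof of A(b) ⊢ φ (resp. φ ⊢ B(b)) of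
-- size at most C (n + 1)².  A rule application marks some ψ and appends its
-- components; ψ follows from those components by a constant number of
-- inferences on sequents of size O(n'), so cutting it into the old proofs costs
-- O(n') symbols.  As every rule application increases the size to n' ≥ n + 1,
-- these linear increments stay below C (n' + 1)² − C (n + 1)².

module Submission where

open import Defs
open import Data.Nat using (ℕ; suc; _+_; _*_; _^_; _≤_; _<_; z≤n; s≤s; z<s; _≤?_)
open import Data.Nat.Properties
open import Data.Nat.Tactic.RingSolver using (solve-∀)
open import Data.Bool using (Bool; true; false)
open import Data.List using (List; []; _∷_; _++_; length; [_]; map)
open import Data.List.Base using (lookup; updateAt)
open import Data.List.Membership.Propositional using (_∈_)
open import Data.List.Membership.Propositional.Properties using (∈-++⁺ˡ; ∈-++⁺ʳ; ∈-++⁻; ∈-map⁻)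
open import Data.List.Relation.Unary.Any using (here; there)
open import Data.List.Relation.Binary.Subset.Propositional using (_⊆_)
open import Data.Fin using (Fin; zero; suc)
open import Data.Product using (Σ; _×_; _,_; proj₁; proj₂)
import Data.Product as Product
open import Data.Sum using (_⊎_; inj₁; inj₂)
import Data.Sum as Sum
open import Relation.Nullary.Decidable using (True; toWitness)
open import Relation.Nullary.Negation using (contradiction)
open import Relation.Binary.PropositionalEquality hiding ([_])
open import Function using (id)

variable
  n n' N N' e e₁ e₂ g d k k₀ k₁ o o₀ o₁ : ℕ
  σ σ₀ : Sign
  A B φ ψ : Formula
  Γ Δ Γ' Δ' Θ : List Formula
  s a₁ a₂ : Signed
  b : Branch
  m : Bool

pattern first  = here refl
pattern second = there (here refl)
pattern third  = there (there (here refl))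

∈-updateAt⁻ : ∀ {V : Set} {x : V} (xs : List V) i f →
              x ∈ xs → lookup xs i ≡ x ⊎ x ∈ updateAt xs i f
∈-updateAt⁻ (_ ∷ _)  zero    f first     = inj₁ refl
∈-updateAt⁻ (_ ∷ _)  zero    f (there p) = inj₂ (there p)
∈-updateAt⁻ (_ ∷ _)  (suc i) f first     = inj₂ first
∈-updateAt⁻ (_ ∷ xs) (suc i) f (there p) = Sum.map₂ there (∈-updateAt⁻ xs i f p)

f-lookup∈updateAt : ∀ {V : Set} (xs : List V) i f → f (lookup xs i) ∈ updateAt xs i f
f-lookup∈updateAt (_ ∷ _)  zero    f = first
f-lookup∈updateAt (_ ∷ xs) (suc i) f = there (f-lookup∈updateAt xs i f)

∈-++-replace⁻ : ∀ {V : Set} {x y : V} (xs ys : List V) {zs} →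
                x ∈ xs ++ ys ++ zs → x ∈ ys ⊎ x ∈ xs ++ y ∷ zs
∈-++-replace⁻ xs ys p with ∈-++⁻ xs p
... | inj₁ q = inj₂ (∈-++⁺ˡ q)
... | inj₂ q with ∈-++⁻ ys q
...   | inj₁ r = inj₁ r
...   | inj₂ r = inj₂ (∈-++⁺ʳ xs (there r))

unmarkedWith-∷ : ∀ σ nd b → unmarkedWith σ b ⊆ unmarkedWith σ (nd ∷ b)
unmarkedWith-∷ T ((T , _) , false) b p = there p
unmarkedWith-∷ T ((T , _) , true)  b p = p
unmarkedWith-∷ T ((F , _) , _)     b p = p
unmarkedWith-∷ F ((F , _) , false) b p = there p
unmarkedWith-∷ F ((F , _) , true)  b p = p
unmarkedWith-∷ F ((T , _) , _)     b p = p

∈-unmarkedWith⁺ : ((σ , φ) , false) ∈ b → φ ∈ unmarkedWith σ b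
∈-unmarkedWith⁺ {T} first = first
∈-unmarkedWith⁺ {F} first = first
∈-unmarkedWith⁺ {σ} {b = nd ∷ b} (there p) = unmarkedWith-∷ σ nd b (∈-unmarkedWith⁺ p)

∈-unmarkedWith⁻ : ∀ σ b → φ ∈ unmarkedWith σ b → ((σ , φ) , false) ∈ b
∈-unmarkedWith⁻ T (((T , _) , false) ∷ b) first     = first
∈-unmarkedWith⁻ T (((T , _) , false) ∷ b) (there p) = there (∈-unmarkedWith⁻ T b p)
∈-unmarkedWith⁻ T (((T , _) , true)  ∷ b) p         = there (∈-unmarkedWith⁻ T b p)
∈-unmarkedWith⁻ T (((F , _) , _)     ∷ b) p         = there (∈-unmarkedWith⁻ T b p)
∈-unmarkedWith⁻ F (((F , _) , false) ∷ b) first     = first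
∈-unmarkedWith⁻ F (((F , _) , false) ∷ b) (there p) = there (∈-unmarkedWith⁻ F b p)
∈-unmarkedWith⁻ F (((F , _) , true)  ∷ b) p         = there (∈-unmarkedWith⁻ F b p)
∈-unmarkedWith⁻ F (((T , _) , _)     ∷ b) p         = there (∈-unmarkedWith⁻ F b p)

OnBranch-mark⁻ : ∀ b i → (s , m) ∈ updateAt b i mark → OnBranch s b
OnBranch-mark⁻ (_ ∷ b) zero    first     = _ , first
OnBranch-mark⁻ (_ ∷ b) zero    (there p) = _ , there p
OnBranch-mark⁻ (_ ∷ b) (suc i) first     = _ , first
OnBranch-mark⁻ (_ ∷ b) (suc i) (there p) = Product.map₂ there (OnBranch-mark⁻ b i p)

unmarked-only : ∀ {V : Set} (f : V → Signed) {vs} →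
                (s , m) ∈ map (λ v → unmarked (f v)) vs → m ≡ false
unmarked-only f p with ∈-map⁻ (λ v → unmarked (f v)) p
... | _ , _ , refl = refl

initBranch-unmarked : ∀ Γ Δ → (s , m) ∈ initBranch Γ Δ → m ≡ false
initBranch-unmarked Γ Δ p with ∈-++⁻ (map (λ γ → unmarked (T , γ)) Γ) p
... | inj₁ q = unmarked-only (T ,_) q
... | inj₂ q = unmarked-only (F ,_) q

expandAt : (b : Branch) → Fin (length b) → List Signed → Branch
expandAt b i rs = updateAt b i mark ++ map unmarked rs

expandAt-marked : ∀ b i rs → lookup b i ≡ unmarked s → OnBranch s (expandAt b i rs)
expandAt-marked b i rs e =
  true , ∈-++⁺ˡ (subst (λ nd → mark nd ∈ updateAt b i mark) e (f-lookup∈updateAt b i mark))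

expandAt-unmarkedWith : ∀ b i rs → lookup b i ≡ unmarked (σ₀ , ψ) → φ ∈ unmarkedWith σ b →
                        (σ , φ) ≡ (σ₀ , ψ) ⊎ φ ∈ unmarkedWith σ (expandAt b i rs)
expandAt-unmarkedWith {σ = σ} b i rs e p with ∈-updateAt⁻ b i mark (∈-unmarkedWith⁻ σ b p)
... | inj₁ e' = inj₁ (cong proj₁ (trans (sym e') e))
... | inj₂ q  = inj₂ (∈-unmarkedWith⁺ (∈-++⁺ˡ q))

marked-replaced : ∀ b i rs → lookup b i ≡ unmarked (σ , ψ) →
                  unmarkedWith σ b ⊆ ψ ∷ unmarkedWith σ (expandAt b i rs)
marked-replaced {σ = σ} b i rs e p with expandAt-unmarkedWith {σ = σ} b i rs e p
... | inj₁ refl = first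
... | inj₂ q    = there q

marked-other : ∀ b i rs → lookup b i ≡ unmarked (σ₀ , ψ) → σ ≢ σ₀ →
               unmarkedWith σ b ⊆ unmarkedWith σ (expandAt b i rs)
marked-other {σ = σ} b i rs e σ≢σ₀ p with expandAt-unmarkedWith {σ = σ} b i rs e p
... | inj₁ eq = contradiction (cong proj₁ eq) σ≢σ₀
... | inj₂ q  = q

α-signs : IsAlpha s a₁ a₂ → proj₁ a₁ ≡ proj₁ s × proj₁ a₂ ≡ proj₁ s
α-signs (α-T∧ _ _)  = refl , refl
α-signs (α-F¬∧ _ _) = refl , refl
α-signs (α-T¬∨ _ _) = refl , refl
α-signs (α-F∨ _ _)  = refl , refl
α-signs (α-T¬⇒ _ _) = refl , refl
α-signs (α-F⇒ _ _)  = refl , refl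
α-signs (α-T¬¬ _)   = refl , refl
α-signs (α-F¬¬ _)   = refl , refl

β-signs : IsBeta s a₁ a₂ → proj₁ a₁ ≡ proj₁ s × proj₁ a₂ ≡ proj₁ s
β-signs (β-T∨ _ _)  = refl , refl
β-signs (β-F¬∨ _ _) = refl , refl
β-signs (β-T¬∧ _ _) = refl , refl
β-signs (β-F∧ _ _)  = refl , refl
β-signs (β-T⇒ _ _)  = refl , refl
β-signs (β-F¬⇒ _ _) = refl , refl

bsize : Branch → ℕ
bsize []            = 0
bsize ((s , _) ∷ b) = ssize s + bsize b

bsize-++ : ∀ b b' → bsize (b ++ b') ≡ bsize b + bsize b'
bsize-++ []            b' = refl
bsize-++ ((s , _) ∷ b) b' = trans (cong (ssize s +_) (bsize-++ b b')) (sym (+-assoc (ssize s) _ _))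

bsize-mark : ∀ b i → bsize (updateAt b i mark) ≡ bsize b
bsize-mark (_ ∷ b)       zero    = refl
bsize-mark ((s , _) ∷ b) (suc i) = cong (ssize s +_) (bsize-mark b i)

bsize-unmarked : ∀ σ Γ → bsize (map (λ γ → unmarked (σ , γ)) Γ) ≡ lsize Γ
bsize-unmarked σ []      = refl
bsize-unmarked σ (A ∷ Γ) = cong (fsize A +_) (bsize-unmarked σ Γ)

bsize-initBranch : ∀ Γ Δ → bsize (initBranch Γ Δ) ≡ initSize Γ Δ
bsize-initBranch Γ Δ = trans (bsize-++ (map (λ γ → unmarked (T , γ)) Γ) _)
                             (cong₂ _+_ (bsize-unmarked T Γ) (bsize-unmarked F Δ))

bsize-expandAt : ∀ b i rs → bsize (expandAt b i rs) ≡ bsize b + bsize (map unmarked rs)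
bsize-expandAt b i rs = trans (bsize-++ (updateAt b i mark) _) (cong (_+ _) (bsize-mark b i))

lsize-unmarkedWith : ∀ σ b → lsize (unmarkedWith σ b) ≤ bsize b
lsize-unmarkedWith σ [] = z≤n
lsize-unmarkedWith T (((T , A) , false) ∷ b) = +-monoʳ-≤ (fsize A) (lsize-unmarkedWith T b)
lsize-unmarkedWith T (((T , A) , true)  ∷ b) = ≤-trans (lsize-unmarkedWith T b) (m≤n+m _ (fsize A))
lsize-unmarkedWith T (((F , A) , _)     ∷ b) = ≤-trans (lsize-unmarkedWith T b) (m≤n+m _ (fsize A))
lsize-unmarkedWith F (((F , A) , false) ∷ b) = +-monoʳ-≤ (fsize A) (lsize-unmarkedWith F b)
lsize-unmarkedWith F (((F , A) , true)  ∷ b) = ≤-trans (lsize-unmarkedWith F b) (m≤n+m _ (fsize A))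
lsize-unmarkedWith F (((T , A) , _)     ∷ b) = ≤-trans (lsize-unmarkedWith F b) (m≤n+m _ (fsize A))

fsize≤bsize : OnBranch (σ , φ) b → fsize φ ≤ bsize b
fsize≤bsize (_ , first)                   = m≤m+n _ _
fsize≤bsize {b = (s , _) ∷ b} (m , there p) = ≤-trans (fsize≤bsize (m , p)) (m≤n+m _ (ssize s))

0<fsize : ∀ A → 0 < fsize A
0<fsize (atom _) = z<s
0<fsize ⊥'       = z<s
0<fsize ⊤'       = z<s
0<fsize (¬' _)   = z<s
0<fsize (_ ∧' _) = z<s
0<fsize (_ ∨' _) = z<s
0<fsize (_ ⇒' _) = z<s

Derivable : ℕ → Signed → Branch → Set
Derivable N (T , φ) b = Σ (LK A[ b ] [ φ ]) λ p → lkSize p ≤ N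
Derivable N (F , φ) b = Σ (LK [ φ ] B[ b ]) λ p → lkSize p ≤ N

Derivable-mono : ∀ s → N ≤ N' → Derivable N s b → Derivable N' s b
Derivable-mono (T , _) N≤N' (p , p≤) = p , ≤-trans p≤ N≤N'
Derivable-mono (F , _) N≤N' (p , p≤) = p , ≤-trans p≤ N≤N'

-- Bounds the number of units (see Bounded) spent by one rule application.
C : ℕ
C = 100

-- Bounded LK derivations

units-+ : ∀ k₁ o₁ k₂ o₂ u → (k₁ * u + o₁) + (k₂ * u + o₂) ≡ (k₁ + k₂) * u + (o₁ + o₂)
units-+ = solve-∀

-- X bounds the size of every formula and context occurring in a proof, so
-- each sequent costs at most a few units of X + 1; Proof Γ Δ k o bounds the
-- size of a proof by k units plus an offset o taken over from a given proof.
module Bounded (X : ℕ) where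

  infix  4 _≤[_]+_
  infixr 6 _⊕_

  -- A record rather than an abbreviation, so that k and o are inferred
  -- from the combinators below.
  record _≤[_]+_ (e k o : ℕ) : Set where
    constructor from-≤
    field to-≤ : e ≤ k * suc X + o
  open _≤[_]+_

  unit : e ≤ X → e ≤[ 1 ]+ 0
  unit e≤X = from-≤ (≤-trans e≤X (≤-trans (n≤1+n X)
    (≤-reflexive (sym (trans (+-identityʳ (1 * suc X)) (*-identityˡ (suc X)))))))

  ∅ : 0 ≤[ 0 ]+ 0
  ∅ = from-≤ z≤n

  _⊕_ : e₁ ≤[ k₀ ]+ o₀ → e₂ ≤[ k₁ ]+ o₁ → e₁ + e₂ ≤[ k₀ + k₁ ]+ (o₀ + o₁)
  _⊕_ {k₀ = k₀} {o₀} {k₁ = k₁} {o₁} (from-≤ p) (from-≤ q) =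
    from-≤ (≤-trans (+-mono-≤ p q) (≤-reflexive (units-+ k₀ o₀ k₁ o₁ (suc X))))

  suc⁺ : e ≤[ k ]+ o → suc e ≤[ suc k ]+ o
  suc⁺ {k = k} {o} (from-≤ p) = from-≤ (s≤s (≤-trans p (+-monoˡ-≤ o (m≤n+m (k * suc X) X))))

  Small : Formula → Set
  Small A = fsize A ≤[ 1 ]+ 0

  Proof : List Formula → List Formula → ℕ → ℕ → Set
  Proof Γ Δ k o = Σ (LK Γ Δ) λ p → lkSize p ≤[ k ]+ o

  coarsen : ∀ K {k o} {k≤K : True (k ≤? K)} → Proof Γ Δ k o → Proof Γ Δ K o
  coarsen K {k≤K = k≤K} (p , from-≤ p≤) =
    p , from-≤ (≤-trans p≤ (+-monoˡ-≤ _ (*-monoˡ-≤ (suc X) (toWitness k≤K))))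

  Rule₁ : List Formula → List Formula → List Formula → List Formula → Set
  Rule₁ Γ₀ Δ₀ Γ Δ = ∀ {g d k o} → lsize Γ ≤[ g ]+ 0 → lsize Δ ≤[ d ]+ 0 →
                    Proof Γ₀ Δ₀ k o → Proof Γ Δ (suc (g + d) + k) o

  Rule₂ : List Formula → List Formula → List Formula → List Formula →
          List Formula → List Formula → Set
  Rule₂ Γ₀ Δ₀ Γ₁ Δ₁ Γ Δ = ∀ {g d k₀ o₀ k₁ o₁} → lsize Γ ≤[ g ]+ 0 → lsize Δ ≤[ d ]+ 0 →
                          Proof Γ₀ Δ₀ k₀ o₀ → Proof Γ₁ Δ₁ k₁ o₁ →
                          Proof Γ Δ (suc (g + d) + (k₀ + k₁)) (o₀ + o₁)

  axᵇ : Small A → Proof [ A ] [ A ] 3 0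
  axᵇ {A} A≤ = ax A , suc⁺ ((A≤ ⊕ ∅) ⊕ (A≤ ⊕ ∅)) ⊕ ∅

  wkᵇ : Γ ⊆ Γ' → Δ ⊆ Δ' → Rule₁ Γ Δ Γ' Δ'
  wkᵇ Γ⊆ Δ⊆ Γ≤ Δ≤ (p , p≤) = wk Γ⊆ Δ⊆ p , suc⁺ (Γ≤ ⊕ Δ≤) ⊕ p≤

  ¬Lᵇ : Rule₁ Γ (A ∷ Δ) (¬' A ∷ Γ) Δ
  ¬Lᵇ Γ≤ Δ≤ (p , p≤) = ¬L p , suc⁺ (Γ≤ ⊕ Δ≤) ⊕ p≤

  ¬Rᵇ : Rule₁ (A ∷ Γ) Δ Γ (¬' A ∷ Δ)
  ¬Rᵇ Γ≤ Δ≤ (p , p≤) = ¬R p , suc⁺ (Γ≤ ⊕ Δ≤) ⊕ p≤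

  ∧L₁ᵇ : Rule₁ (A ∷ Γ) Δ (A ∧' B ∷ Γ) Δ
  ∧L₁ᵇ Γ≤ Δ≤ (p , p≤) = ∧L₁ p , suc⁺ (Γ≤ ⊕ Δ≤) ⊕ p≤

  ∧L₂ᵇ : Rule₁ (B ∷ Γ) Δ (A ∧' B ∷ Γ) Δ
  ∧L₂ᵇ Γ≤ Δ≤ (p , p≤) = ∧L₂ p , suc⁺ (Γ≤ ⊕ Δ≤) ⊕ p≤

  ∨R₁ᵇ : Rule₁ Γ (A ∷ Δ) Γ (A ∨' B ∷ Δ)
  ∨R₁ᵇ Γ≤ Δ≤ (p , p≤) = ∨R₁ p , suc⁺ (Γ≤ ⊕ Δ≤) ⊕ p≤

  ∨R₂ᵇ : Rule₁ Γ (B ∷ Δ) Γ (A ∨' B ∷ Δ)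
  ∨R₂ᵇ Γ≤ Δ≤ (p , p≤) = ∨R₂ p , suc⁺ (Γ≤ ⊕ Δ≤) ⊕ p≤

  ⇒Rᵇ : Rule₁ (A ∷ Γ) (B ∷ Δ) Γ (A ⇒' B ∷ Δ)
  ⇒Rᵇ Γ≤ Δ≤ (p , p≤) = ⇒R p , suc⁺ (Γ≤ ⊕ Δ≤) ⊕ p≤

  ∧Rᵇ : Rule₂ Γ (A ∷ Δ) Γ (B ∷ Δ) Γ (A ∧' B ∷ Δ)
  ∧Rᵇ Γ≤ Δ≤ (p , p≤) (q , q≤) = ∧R p q , suc⁺ (Γ≤ ⊕ Δ≤) ⊕ (p≤ ⊕ q≤)

  ∨Lᵇ : Rule₂ (A ∷ Γ) Δ (B ∷ Γ) Δ (A ∨' B ∷ Γ) Δ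
  ∨Lᵇ Γ≤ Δ≤ (p , p≤) (q , q≤) = ∨L p q , suc⁺ (Γ≤ ⊕ Δ≤) ⊕ (p≤ ⊕ q≤)

  ⇒Lᵇ : Rule₂ Γ (A ∷ Δ) (B ∷ Γ) Δ (A ⇒' B ∷ Γ) Δ
  ⇒Lᵇ Γ≤ Δ≤ (p , p≤) (q , q≤) = ⇒L p q , suc⁺ (Γ≤ ⊕ Δ≤) ⊕ (p≤ ⊕ q≤)

  cutᵇ : Rule₂ Γ (A ∷ Δ) (A ∷ Γ) Δ Γ Δ
  cutᵇ {A = A} Γ≤ Δ≤ (p , p≤) (q , q≤) = cut A p q , suc⁺ (Γ≤ ⊕ Δ≤) ⊕ (p≤ ⊕ q≤)

  axiom : A ∈ Γ → A ∈ Δ → lsize Γ ≤[ g ]+ 0 → lsize Δ ≤[ d ]+ 0 → Small A →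
          Proof Γ Δ (suc (g + d) + 3) 0
  axiom A∈Γ A∈Δ Γ≤ Δ≤ A≤ = wkᵇ (λ { first → A∈Γ }) (λ { first → A∈Δ }) Γ≤ Δ≤ (axᵇ A≤)

  non-contradiction : ¬' A ∈ Γ → A ∈ Γ → lsize Γ ≤[ g ]+ 0 → lsize Δ ≤[ d ]+ 0 → Small A →
                     Proof Γ Δ (suc (g + d) + 7) 0
  non-contradiction ¬A∈Γ A∈Γ Γ≤ Δ≤ A≤ =
    wkᵇ (λ { first → ¬A∈Γ ; second → A∈Γ }) (λ ()) Γ≤ Δ≤ (¬Lᵇ (suc⁺ A≤ ⊕ A≤ ⊕ ∅) ∅ (axᵇ A≤))

  excluded-middle : ¬' A ∈ Δ → A ∈ Δ → lsize Γ ≤[ g ]+ 0 → lsize Δ ≤[ d ]+ 0 → Small A →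
                    Proof Γ Δ (suc (g + d) + 7) 0
  excluded-middle ¬A∈Δ A∈Δ Γ≤ Δ≤ A≤ =
    wkᵇ (λ ()) (λ { first → ¬A∈Δ ; second → A∈Δ }) Γ≤ Δ≤ (¬Rᵇ ∅ (suc⁺ A≤ ⊕ A≤ ⊕ ∅) (axᵇ A≤))

  ∧-intro : Small A → Small B → Proof (A ∷ B ∷ []) [ A ∧' B ] 60 0
  ∧-intro A≤ B≤ = coarsen 60
    (∧Rᵇ (A≤ ⊕ B≤ ⊕ ∅) (suc⁺ (A≤ ⊕ B≤) ⊕ ∅)
      (axiom first  first (A≤ ⊕ B≤ ⊕ ∅) (A≤ ⊕ ∅) A≤)
      (axiom second first (A≤ ⊕ B≤ ⊕ ∅) (B≤ ⊕ ∅) B≤))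

  ¬∨-intro : Small A → Small B → Proof (¬' A ∷ ¬' B ∷ []) [ ¬' (A ∨' B) ] 60 0
  ¬∨-intro A≤ B≤ = coarsen 60
    (¬Rᵇ (suc⁺ A≤ ⊕ suc⁺ B≤ ⊕ ∅) (suc⁺ (suc⁺ (A≤ ⊕ B≤)) ⊕ ∅)
      (∨Lᵇ (suc⁺ (A≤ ⊕ B≤) ⊕ suc⁺ A≤ ⊕ suc⁺ B≤ ⊕ ∅) ∅
        (non-contradiction second first (A≤ ⊕ suc⁺ A≤ ⊕ suc⁺ B≤ ⊕ ∅) ∅ A≤)
        (non-contradiction third  first (B≤ ⊕ suc⁺ A≤ ⊕ suc⁺ B≤ ⊕ ∅) ∅ B≤)))

  ¬⇒-intro : Small A → Small B → Proof (A ∷ ¬' B ∷ []) [ ¬' (A ⇒' B) ] 60 0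
  ¬⇒-intro A≤ B≤ = coarsen 60
    (¬Rᵇ (A≤ ⊕ suc⁺ B≤ ⊕ ∅) (suc⁺ (suc⁺ (A≤ ⊕ B≤)) ⊕ ∅)
      (⇒Lᵇ (suc⁺ (A≤ ⊕ B≤) ⊕ A≤ ⊕ suc⁺ B≤ ⊕ ∅) ∅
        (axiom first first (A≤ ⊕ suc⁺ B≤ ⊕ ∅) (A≤ ⊕ ∅) A≤)
        (non-contradiction third first (B≤ ⊕ A≤ ⊕ suc⁺ B≤ ⊕ ∅) ∅ B≤)))

  ¬¬-intro : Small A → Proof (A ∷ A ∷ []) [ ¬' ¬' A ] 60 0
  ¬¬-intro A≤ = coarsen 60
    (¬Rᵇ (A≤ ⊕ A≤ ⊕ ∅) (suc⁺ (suc⁺ A≤) ⊕ ∅)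
      (non-contradiction first second (suc⁺ A≤ ⊕ A≤ ⊕ A≤ ⊕ ∅) ∅ A≤))

  ∨-elim : Small A → Small B → Proof [ A ∨' B ] (A ∷ B ∷ []) 60 0
  ∨-elim A≤ B≤ = coarsen 60
    (∨Lᵇ (suc⁺ (A≤ ⊕ B≤) ⊕ ∅) (A≤ ⊕ B≤ ⊕ ∅)
      (axiom first first  (A≤ ⊕ ∅) (A≤ ⊕ B≤ ⊕ ∅) A≤)
      (axiom first second (B≤ ⊕ ∅) (A≤ ⊕ B≤ ⊕ ∅) B≤))

  ¬∧-elim : Small A → Small B → Proof [ ¬' (A ∧' B) ] (¬' A ∷ ¬' B ∷ []) 60 0
  ¬∧-elim A≤ B≤ = coarsen 60
    (¬Lᵇ (suc⁺ (suc⁺ (A≤ ⊕ B≤)) ⊕ ∅) (suc⁺ A≤ ⊕ suc⁺ B≤ ⊕ ∅)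
      (∧Rᵇ ∅ (suc⁺ (A≤ ⊕ B≤) ⊕ suc⁺ A≤ ⊕ suc⁺ B≤ ⊕ ∅)
        (excluded-middle second first ∅ (A≤ ⊕ suc⁺ A≤ ⊕ suc⁺ B≤ ⊕ ∅) A≤)
        (excluded-middle third  first ∅ (B≤ ⊕ suc⁺ A≤ ⊕ suc⁺ B≤ ⊕ ∅) B≤)))

  ⇒-elim : Small A → Small B → Proof [ A ⇒' B ] (¬' A ∷ B ∷ []) 60 0
  ⇒-elim A≤ B≤ = coarsen 60
    (⇒Lᵇ (suc⁺ (A≤ ⊕ B≤) ⊕ ∅) (suc⁺ A≤ ⊕ B≤ ⊕ ∅)
      (excluded-middle second first ∅ (A≤ ⊕ suc⁺ A≤ ⊕ B≤ ⊕ ∅) A≤)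
      (axiom first second (B≤ ⊕ ∅) (suc⁺ A≤ ⊕ B≤ ⊕ ∅) B≤))

  ¬¬-elim : Small A → Proof [ ¬' ¬' A ] (A ∷ A ∷ []) 60 0
  ¬¬-elim A≤ = coarsen 60
    (¬Lᵇ (suc⁺ (suc⁺ A≤) ⊕ ∅) (A≤ ⊕ A≤ ⊕ ∅)
      (excluded-middle first second ∅ (suc⁺ A≤ ⊕ A≤ ⊕ A≤ ⊕ ∅) A≤))

  ∨-intro₁ : Small A → Small B → Proof [ A ] [ A ∨' B ] 60 0
  ∨-intro₁ A≤ B≤ = coarsen 60 (∨R₁ᵇ (A≤ ⊕ ∅) (suc⁺ (A≤ ⊕ B≤) ⊕ ∅) (axᵇ A≤))

  ∨-intro₂ : Small A → Small B → Proof [ B ] [ A ∨' B ] 60 0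
  ∨-intro₂ A≤ B≤ = coarsen 60 (∨R₂ᵇ (B≤ ⊕ ∅) (suc⁺ (A≤ ⊕ B≤) ⊕ ∅) (axᵇ B≤))

  ¬∧-intro₁ : Small A → Small B → Proof [ ¬' A ] [ ¬' (A ∧' B) ] 60 0
  ¬∧-intro₁ A≤ B≤ = coarsen 60
    (¬Rᵇ (suc⁺ A≤ ⊕ ∅) (suc⁺ (suc⁺ (A≤ ⊕ B≤)) ⊕ ∅)
      (∧L₁ᵇ (suc⁺ (A≤ ⊕ B≤) ⊕ suc⁺ A≤ ⊕ ∅) ∅
        (non-contradiction second first (A≤ ⊕ suc⁺ A≤ ⊕ ∅) ∅ A≤)))

  ¬∧-intro₂ : Small A → Small B → Proof [ ¬' B ] [ ¬' (A ∧' B) ] 60 0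
  ¬∧-intro₂ A≤ B≤ = coarsen 60
    (¬Rᵇ (suc⁺ B≤ ⊕ ∅) (suc⁺ (suc⁺ (A≤ ⊕ B≤)) ⊕ ∅)
      (∧L₂ᵇ (suc⁺ (A≤ ⊕ B≤) ⊕ suc⁺ B≤ ⊕ ∅) ∅
        (non-contradiction second first (B≤ ⊕ suc⁺ B≤ ⊕ ∅) ∅ B≤)))

  ⇒-intro₁ : Small A → Small B → Proof [ ¬' A ] [ A ⇒' B ] 60 0
  ⇒-intro₁ A≤ B≤ = coarsen 60
    (⇒Rᵇ (suc⁺ A≤ ⊕ ∅) (suc⁺ (A≤ ⊕ B≤) ⊕ ∅)
      (non-contradiction second first (A≤ ⊕ suc⁺ A≤ ⊕ ∅) (B≤ ⊕ ∅) A≤))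

  ⇒-intro₂ : Small A → Small B → Proof [ B ] [ A ⇒' B ] 60 0
  ⇒-intro₂ A≤ B≤ = coarsen 60
    (⇒Rᵇ (B≤ ⊕ ∅) (suc⁺ (A≤ ⊕ B≤) ⊕ ∅) (axiom second first (A≤ ⊕ B≤ ⊕ ∅) (B≤ ⊕ ∅) B≤))

  ∧-elim₁ : Small A → Small B → Proof [ A ∧' B ] [ A ] 60 0
  ∧-elim₁ A≤ B≤ = coarsen 60 (∧L₁ᵇ (suc⁺ (A≤ ⊕ B≤) ⊕ ∅) (A≤ ⊕ ∅) (axᵇ A≤))

  ∧-elim₂ : Small A → Small B → Proof [ A ∧' B ] [ B ] 60 0
  ∧-elim₂ A≤ B≤ = coarsen 60 (∧L₂ᵇ (suc⁺ (A≤ ⊕ B≤) ⊕ ∅) (B≤ ⊕ ∅) (axᵇ B≤))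

  ¬∨-elim₁ : Small A → Small B → Proof [ ¬' (A ∨' B) ] [ ¬' A ] 60 0
  ¬∨-elim₁ A≤ B≤ = coarsen 60
    (¬Lᵇ (suc⁺ (suc⁺ (A≤ ⊕ B≤)) ⊕ ∅) (suc⁺ A≤ ⊕ ∅)
      (∨R₁ᵇ ∅ (suc⁺ (A≤ ⊕ B≤) ⊕ suc⁺ A≤ ⊕ ∅)
        (excluded-middle second first ∅ (A≤ ⊕ suc⁺ A≤ ⊕ ∅) A≤)))

  ¬∨-elim₂ : Small A → Small B → Proof [ ¬' (A ∨' B) ] [ ¬' B ] 60 0
  ¬∨-elim₂ A≤ B≤ = coarsen 60
    (¬Lᵇ (suc⁺ (suc⁺ (A≤ ⊕ B≤)) ⊕ ∅) (suc⁺ B≤ ⊕ ∅)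
      (∨R₂ᵇ ∅ (suc⁺ (A≤ ⊕ B≤) ⊕ suc⁺ B≤ ⊕ ∅)
        (excluded-middle second first ∅ (B≤ ⊕ suc⁺ B≤ ⊕ ∅) B≤)))

  ¬⇒-elim₁ : Small A → Small B → Proof [ ¬' (A ⇒' B) ] [ A ] 60 0
  ¬⇒-elim₁ A≤ B≤ = coarsen 60
    (¬Lᵇ (suc⁺ (suc⁺ (A≤ ⊕ B≤)) ⊕ ∅) (A≤ ⊕ ∅)
      (⇒Rᵇ ∅ (suc⁺ (A≤ ⊕ B≤) ⊕ A≤ ⊕ ∅)
        (axiom first second (A≤ ⊕ ∅) (B≤ ⊕ A≤ ⊕ ∅) A≤)))

  ¬⇒-elim₂ : Small A → Small B → Proof [ ¬' (A ⇒' B) ] [ ¬' B ] 60 0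
  ¬⇒-elim₂ A≤ B≤ = coarsen 60
    (¬Lᵇ (suc⁺ (suc⁺ (A≤ ⊕ B≤)) ⊕ ∅) (suc⁺ B≤ ⊕ ∅)
      (⇒Rᵇ ∅ (suc⁺ (A≤ ⊕ B≤) ⊕ suc⁺ B≤ ⊕ ∅)
        (excluded-middle second first (A≤ ⊕ ∅) (B≤ ⊕ suc⁺ B≤ ⊕ ∅) B≤)))

  operandˡ : suc (e₁ + e₂) ≤ X → e₁ ≤[ 1 ]+ 0
  operandˡ {e₁} {e₂} p = unit (≤-trans (m≤m+n e₁ e₂) (≤-trans (n≤1+n _) p))

  operandʳ : suc (e₁ + e₂) ≤ X → e₂ ≤[ 1 ]+ 0
  operandʳ {e₁} {e₂} p = unit (≤-trans (m≤n+m e₂ e₁) (≤-trans (n≤1+n _) p))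


  Expansion : Signed → List Formula → Set
  Expansion (T , ψ) Θ = Proof Θ [ ψ ] 60 0
  Expansion (F , ψ) Θ = Proof [ ψ ] Θ 60 0

  α-expansion : IsAlpha s a₁ a₂ → fsize (proj₂ s) ≤ X → Expansion s (proj₂ a₁ ∷ proj₂ a₂ ∷ [])
  α-expansion (α-T∧ A B)  ψ≤ = ∧-intro  (operandˡ ψ≤) (operandʳ ψ≤)
  α-expansion (α-F¬∧ A B) ψ≤ = ¬∧-elim  (operandˡ (<⇒≤ ψ≤)) (operandʳ (<⇒≤ ψ≤))
  α-expansion (α-T¬∨ A B) ψ≤ = ¬∨-intro (operandˡ (<⇒≤ ψ≤)) (operandʳ (<⇒≤ ψ≤))
  α-expansion (α-F∨ A B)  ψ≤ = ∨-elim   (operandˡ ψ≤) (operandʳ ψ≤)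
  α-expansion (α-T¬⇒ A B) ψ≤ = ¬⇒-intro (operandˡ (<⇒≤ ψ≤)) (operandʳ (<⇒≤ ψ≤))
  α-expansion (α-F⇒ A B)  ψ≤ = ⇒-elim   (operandˡ ψ≤) (operandʳ ψ≤)
  α-expansion (α-T¬¬ A)   ψ≤ = ¬¬-intro (unit (<⇒≤ (<⇒≤ ψ≤)))
  α-expansion (α-F¬¬ A)   ψ≤ = ¬¬-elim  (unit (<⇒≤ (<⇒≤ ψ≤)))

  β-expansion : IsBeta s a₁ a₂ → fsize (proj₂ s) ≤ X →
                Expansion s [ proj₂ a₁ ] × Expansion s [ proj₂ a₂ ]
  β-expansion (β-T∨ A B)  ψ≤ = ∨-intro₁ (operandˡ ψ≤) (operandʳ ψ≤)
                             , ∨-intro₂ (operandˡ ψ≤) (operandʳ ψ≤)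
  β-expansion (β-F¬∨ A B) ψ≤ = ¬∨-elim₁ (operandˡ (<⇒≤ ψ≤)) (operandʳ (<⇒≤ ψ≤))
                             , ¬∨-elim₂ (operandˡ (<⇒≤ ψ≤)) (operandʳ (<⇒≤ ψ≤))
  β-expansion (β-T¬∧ A B) ψ≤ = ¬∧-intro₁ (operandˡ (<⇒≤ ψ≤)) (operandʳ (<⇒≤ ψ≤))
                             , ¬∧-intro₂ (operandˡ (<⇒≤ ψ≤)) (operandʳ (<⇒≤ ψ≤))
  β-expansion (β-F∧ A B)  ψ≤ = ∧-elim₁ (operandˡ ψ≤) (operandʳ ψ≤)
                             , ∧-elim₂ (operandˡ ψ≤) (operandʳ ψ≤)
  β-expansion (β-T⇒ A B)  ψ≤ = ⇒-intro₁ (operandˡ ψ≤) (operandʳ ψ≤)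
                             , ⇒-intro₂ (operandˡ ψ≤) (operandʳ ψ≤)
  β-expansion (β-F¬⇒ A B) ψ≤ = ¬⇒-elim₁ (operandˡ (<⇒≤ ψ≤)) (operandʳ (<⇒≤ ψ≤))
                             , ¬⇒-elim₂ (operandˡ (<⇒≤ ψ≤)) (operandʳ (<⇒≤ ψ≤))

  formula≤ : bsize b ≤ X → OnBranch (σ , φ) b → fsize φ ≤ X
  formula≤ fits on = ≤-trans (fsize≤bsize on) fits

  context : ∀ σ b → bsize b ≤ X → lsize (unmarkedWith σ b) ≤[ 1 ]+ 0
  context σ b fits = unit (≤-trans (lsize-unmarkedWith σ b) fits)

  LinearlyDerivable : Signed → Branch → Set
  LinearlyDerivable (T , ψ) b = Proof A[ b ] [ ψ ] 70 0
  LinearlyDerivable (F , ψ) b = Proof [ ψ ] B[ b ] 70 0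

  weaken-expansion : ∀ σ b → bsize b ≤ X → fsize ψ ≤ X → Θ ⊆ unmarkedWith σ b →
                     Expansion (σ , ψ) Θ → LinearlyDerivable (σ , ψ) b
  weaken-expansion T b fits ψ≤ Θ⊆ p = coarsen 70 (wkᵇ Θ⊆ id (context T b fits) (unit ψ≤ ⊕ ∅) p)
  weaken-expansion F b fits ψ≤ Θ⊆ p = coarsen 70 (wkᵇ id Θ⊆ (unit ψ≤ ⊕ ∅) (context F b fits) p)

  α-derivable : IsAlpha s a₁ a₂ → bsize b ≤ X → OnBranch s b →
                (a₁ , false) ∈ b → (a₂ , false) ∈ b → LinearlyDerivable s b
  α-derivable {s = σ , ψ} {a₁ = _ , _} {a₂ = _ , _} α fits on m₁ m₂ with α-signs α
  ... | refl , refl = weaken-expansion σ _ fits ψ≤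
        (λ { first → ∈-unmarkedWith⁺ m₁ ; second → ∈-unmarkedWith⁺ m₂ }) (α-expansion α ψ≤)
    where
    ψ≤ : fsize ψ ≤ X
    ψ≤ = formula≤ fits on

  β-derivable : IsBeta s a₁ a₂ → bsize b ≤ X → OnBranch s b →
                (a₁ , false) ∈ b ⊎ (a₂ , false) ∈ b → LinearlyDerivable s b
  β-derivable {s = σ , ψ} {a₁ = _ , _} {a₂ = _ , _} β fits on m with β-signs β | m
  ... | refl , refl | inj₁ m₁ =
    weaken-expansion σ _ fits ψ≤ (λ { first → ∈-unmarkedWith⁺ m₁ }) (proj₁ (β-expansion β ψ≤))
    where
    ψ≤ : fsize ψ ≤ X
    ψ≤ = formula≤ fits on
  ... | refl , refl | inj₂ m₂ =
    weaken-expansion σ _ fits ψ≤ (λ { first → ∈-unmarkedWith⁺ m₂ }) (proj₂ (β-expansion β ψ≤))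
    where
    ψ≤ : fsize ψ ≤ X
    ψ≤ = formula≤ fits on

  with-offset : (p : LK Γ Δ) → lkSize p ≤ N → Proof Γ Δ 0 N
  with-offset p p≤ = p , from-≤ p≤

  conclude : Proof Γ Δ k o → {k≤C : True (k ≤? C)} → o ≤ N →
             Σ (LK Γ Δ) λ p → lkSize p ≤ C * suc X + N
  conclude (p , from-≤ p≤) {k≤C} o≤N =
    p , ≤-trans p≤ (+-mono-≤ (*-monoˡ-≤ (suc X) (toWitness k≤C)) o≤N)

  derivable-unmarked : ∀ s b → bsize b ≤ X → (s , false) ∈ b → Derivable (C * suc X + N) s b
  derivable-unmarked (T , φ) b fits φ∈ =
    conclude (axiom (∈-unmarkedWith⁺ φ∈) first (context T b fits) (unit φ≤ ⊕ ∅) (unit φ≤)) z≤n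
    where
    φ≤ : fsize φ ≤ X
    φ≤ = formula≤ fits (false , φ∈)
  derivable-unmarked (F , φ) b fits φ∈ =
    conclude (axiom first (∈-unmarkedWith⁺ φ∈) (unit φ≤ ⊕ ∅) (context F b fits) (unit φ≤)) z≤n
    where
    φ≤ : fsize φ ≤ X
    φ≤ = formula≤ fits (false , φ∈)

  -- Marking ψ removes it from the hypotheses of the branch; derivations that
  -- used it are repaired by a cut against its derivation from its components.
  derivable-expandAt : ∀ b i rs {s₀ s} → lookup b i ≡ unmarked s₀ →
                       bsize (expandAt b i rs) ≤ X → OnBranch s (expandAt b i rs) →
                       LinearlyDerivable s₀ (expandAt b i rs) →
                       Derivable N s b → Derivable (C * suc X + N) s (expandAt b i rs)
  derivable-expandAt {N} b i rs {σ₀ , ψ} {σ , φ} e fits on = by-signs σ₀ σ e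
    where
    ψ≤ : Small ψ
    ψ≤ = unit (formula≤ fits (expandAt-marked b i rs e))
    φ≤ : Small φ
    φ≤ = unit (formula≤ fits on)
    Γ≤ : lsize A[ expandAt b i rs ] ≤[ 1 ]+ 0
    Γ≤ = context T (expandAt b i rs) fits
    Δ≤ : lsize B[ expandAt b i rs ] ≤[ 1 ]+ 0
    Δ≤ = context F (expandAt b i rs) fits
    by-signs : ∀ σ₀ σ → lookup b i ≡ unmarked (σ₀ , ψ) →
               LinearlyDerivable (σ₀ , ψ) (expandAt b i rs) →
               Derivable N (σ , φ) b → Derivable (C * suc X + N) (σ , φ) (expandAt b i rs)
    by-signs T T e key (p , p≤) = conclude
      (cutᵇ Γ≤ (φ≤ ⊕ ∅)
        (wkᵇ id (λ { first → first }) Γ≤ (ψ≤ ⊕ φ≤ ⊕ ∅) key)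
        (wkᵇ (marked-replaced b i rs e) id (ψ≤ ⊕ Γ≤) (φ≤ ⊕ ∅) (with-offset p p≤)))
      ≤-refl
    by-signs F F e key (p , p≤) = conclude
      (cutᵇ (φ≤ ⊕ ∅) Δ≤
        (wkᵇ id (marked-replaced b i rs e) (φ≤ ⊕ ∅) (ψ≤ ⊕ Δ≤) (with-offset p p≤))
        (wkᵇ (λ { first → first }) id (ψ≤ ⊕ φ≤ ⊕ ∅) Δ≤ key))
      (≤-reflexive (+-identityʳ N))
    by-signs F T e _ (p , p≤) = conclude
      (wkᵇ (marked-other b i rs e λ ()) id Γ≤ (φ≤ ⊕ ∅) (with-offset p p≤)) ≤-refl
    by-signs T F e _ (p , p≤) = conclude
      (wkᵇ id (marked-other b i rs e λ ()) (φ≤ ⊕ ∅) Δ≤ (with-offset p p≤)) ≤-refl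

-- The invariant

square-growth : suc n ≤ n' → suc n' + suc n ^ 2 ≤ suc n' ^ 2
square-growth {n} {n'} n<n' = begin
  suc n' + suc n * (suc n * 1) ≡⟨ cong (λ t → suc n' + suc n * t) (*-identityʳ (suc n)) ⟩
  suc n' + suc n * suc n       ≤⟨ +-monoʳ-≤ (suc n') (*-monoˡ-≤ (suc n) (≤-trans n<n' (n≤1+n n'))) ⟩
  suc n' + suc n' * suc n      ≡⟨ sym (*-suc (suc n') (suc n)) ⟩
  suc n' * suc (suc n)         ≤⟨ *-monoʳ-≤ (suc n') (s≤s n<n') ⟩
  suc n' * suc n'              ≡⟨ cong (suc n' *_) (sym (*-identityʳ (suc n'))) ⟩
  suc n' * (suc n' * 1)        ∎
  where open ≤-Reasoning

quadratic-step : suc n ≤ n' → C * suc n' + C * suc n ^ 2 ≤ C * suc n' ^ 2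
quadratic-step {n} {n'} n<n' =
  ≤-trans (≤-reflexive (sym (*-distribˡ-+ C (suc n') (suc n ^ 2))))
          (*-monoʳ-≤ C (square-growth n<n'))

linear≤quadratic : C * suc n + 0 ≤ C * suc n ^ 2
linear≤quadratic {n} =
  ≤-trans (≤-reflexive (+-identityʳ _)) (*-monoʳ-≤ C (m≤m*n (suc n) (suc n * 1)))

tableau-grows : ∀ n (c₁ c₂ : Signed) → n < n + ssize c₁ + ssize c₂
tableau-grows n c₁ c₂ = ≤-trans (m<m+n n (0<fsize (proj₂ c₁))) (m≤m+n _ (ssize c₂))

record Invariant (n : ℕ) (b : Branch) : Set where
  field
    bsize≤ : bsize b ≤ n
    derive : ∀ {s} → OnBranch s b → Derivable (C * suc n ^ 2) s b

Invariant-mono : n ≤ n' → Invariant n b → Invariant n' b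
Invariant-mono n≤n' inv = record
  { bsize≤ = ≤-trans (bsize≤ inv) n≤n'
  ; derive = λ {s} on → Derivable-mono s (*-monoʳ-≤ C (^-monoˡ-≤ 2 (s≤s n≤n'))) (derive inv on)
  }
  where open Invariant

initial-invariant : ∀ Γ Δ → Invariant (initSize Γ Δ) (initBranch Γ Δ)
initial-invariant Γ Δ = record { bsize≤ = fits ; derive = derive }
  where
  fits : bsize (initBranch Γ Δ) ≤ initSize Γ Δ
  fits = ≤-reflexive (bsize-initBranch Γ Δ)
  derive : ∀ {s} → OnBranch s (initBranch Γ Δ) →
           Derivable (C * suc (initSize Γ Δ) ^ 2) s (initBranch Γ Δ)
  derive {s} (m , s∈) = Derivable-mono s linear≤quadratic
    (Bounded.derivable-unmarked (initSize Γ Δ) s _ fits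
      (subst (λ m → (s , m) ∈ initBranch Γ Δ) (initBranch-unmarked Γ Δ s∈) s∈))

invariant-expandAt : ∀ {n b s₀} i rs c₁ c₂ → Invariant n b → lookup b i ≡ unmarked s₀ →
                     bsize (map unmarked rs) ≤ ssize c₁ + ssize c₂ →
                     (bsize (expandAt b i rs) ≤ n + ssize c₁ + ssize c₂ →
                      Bounded.LinearlyDerivable (n + ssize c₁ + ssize c₂) s₀ (expandAt b i rs)) →
                     Invariant (n + ssize c₁ + ssize c₂) (expandAt b i rs)
invariant-expandAt {n} {b} i rs c₁ c₂ inv e rs≤ key = record { bsize≤ = fits ; derive = derive }
  where
  n⁺ : ℕ
  n⁺ = n + ssize c₁ + ssize c₂
  open Bounded n⁺
  fits : bsize (expandAt b i rs) ≤ n⁺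
  fits = begin
    bsize (expandAt b i rs)          ≡⟨ bsize-expandAt b i rs ⟩
    bsize b + bsize (map unmarked rs) ≤⟨ +-mono-≤ (Invariant.bsize≤ inv) rs≤ ⟩
    n + (ssize c₁ + ssize c₂)         ≡⟨ sym (+-assoc n _ _) ⟩
    n⁺                                ∎
    where open ≤-Reasoning
  extend : ∀ {s m} → OnBranch s (expandAt b i rs) → (s , m) ∈ expandAt b i rs →
           Derivable (C * suc n⁺ + C * suc n ^ 2) s (expandAt b i rs)
  extend on s∈ with ∈-++⁻ (updateAt b i mark) s∈
  ... | inj₁ s∈b  = derivable-expandAt b i rs e fits on (key fits)
                       (Invariant.derive inv (OnBranch-mark⁻ b i s∈b))
  ... | inj₂ s∈rs = derivable-unmarked _ _ fits
                       (subst (λ m → (_ , m) ∈ _) (unmarked-only id s∈rs) s∈)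
  derive : ∀ {s} → OnBranch s (expandAt b i rs) → Derivable (C * suc n⁺ ^ 2) s (expandAt b i rs)
  derive {s} on = Derivable-mono s (quadratic-step (tableau-grows n c₁ c₂)) (extend on (proj₂ on))

invariant : ∀ {Γ Δ bs n b} → OTAB Γ Δ bs n → b ∈ bs → Invariant n b
invariant {Γ} {Δ} init first = initial-invariant Γ Δ
invariant (ruleA {bs₁} b i {a₁ = a₁} {a₂} t e α) b∈ with ∈-++-replace⁻ bs₁ (_ ∷ []) b∈
... | inj₂ b∈old = Invariant-mono (<⇒≤ (tableau-grows _ a₁ a₂)) (invariant t b∈old)
... | inj₁ first = invariant-expandAt i (a₁ ∷ a₂ ∷ []) a₁ a₂ (invariant t (∈-++⁺ʳ bs₁ first)) e
  (≤-reflexive (cong (ssize a₁ +_) (+-identityʳ _)))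
  (λ fits → Bounded.α-derivable _ α fits (expandAt-marked b i _ e)
                                 (∈-++⁺ʳ _ first) (∈-++⁺ʳ _ second))
invariant (ruleB {bs₁} b i {b₁ = c₁} {c₂} t e β) b∈ with ∈-++-replace⁻ bs₁ (_ ∷ _ ∷ []) b∈
... | inj₂ b∈old = Invariant-mono (<⇒≤ (tableau-grows _ c₁ c₂)) (invariant t b∈old)
... | inj₁ first = invariant-expandAt i [ c₁ ] c₁ c₂ (invariant t (∈-++⁺ʳ bs₁ first)) e
  (+-monoʳ-≤ (ssize c₁) z≤n)
  (λ fits → Bounded.β-derivable _ β fits (expandAt-marked b i _ e) (inj₁ (∈-++⁺ʳ _ first)))
... | inj₁ second = invariant-expandAt i [ c₂ ] c₁ c₂ (invariant t (∈-++⁺ʳ bs₁ first)) e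
  (≤-trans (≤-reflexive (+-identityʳ _)) (m≤n+m _ (ssize c₁)))
  (λ fits → Bounded.β-derivable _ β fits (expandAt-marked b i _ e) (inj₂ (∈-++⁺ʳ _ first)))

lemma5 : Σ ℕ λ c → Σ ℕ λ k →
    ∀ (Γ Δ : List Formula) (bs : List Branch) (n : ℕ) → OTAB Γ Δ bs n →
    ∀ (b : Branch) → b ∈ bs → ∀ (φ : Formula) →
      (OnBranch (T , φ) b → Σ (LK A[ b ] [ φ ]) λ p → lkSize p ≤ c * suc n ^ k)
      × (OnBranch (F , φ) b → Σ (LK [ φ ] B[ b ]) λ p → lkSize p ≤ c * suc n ^ k)
lemma5 = C , 2 , λ _ _ _ _ t _ b∈ _ → derive (invariant t b∈) , derive (invariant t b∈)
  where open Invariant
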